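{- For every $n\ge1$ and any input sequence $s\in\{0,1\}^{\ell}$ with $0\le\ell\le n$, there exists an adaptive algorithm that exactly recovers $s$ using at most $n+1$ queries of length at most $n$, where each query $q$ returns the exact DTW distance $d_{\mathrm{DTW}}(s,q)$, and the query sequences use one extra character (a real number outside $\{0,1\}$) in addition to $0$ and $1$.
   Context: Sequences are finite sequences of real numbers. An expansion of a sequence $x$ is any sequence obtained from $x$ by replacing each character by one or more consecutive copies of itself (i.e., extending its runs). For sequences $x,y$, a correspondence is a pair $(\bar x,\bar y)$ of expansions of $x$ and $y$ of equal length; the DTW distance is $d_{\mathrm{DTW}}(x,y)=\min_{(\bar x,\bar y)}\|\bar x-\bar y\|_1$ over all correspondences. Query model: $s$ is unknown (its length too); the algorithm chooses query sequences, possibly depending on previous answers (adaptive), and receives $d_{\mathrm{DTW}}(s,q)$. -}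

module Defs where

open import Data.Bool using (Bool; true; false)
open import Data.List using (List; []; _∷_; length; map; zipWith; sum)
open import Data.List.Relation.Unary.All using (All)
open import Data.Maybe using (Maybe; just; nothing)
open import Data.Nat using (ℕ; suc) renaming (_≤_ to _≤ℕ_)
open import Data.Product using (Σ; _×_; _,_; ∃₂)
open import Data.Sum using (_⊎_)
open import Data.Rational using (ℚ; 0ℚ; 1ℚ; _-_; ∣_∣; _≤_)
open import Data.Rational using () renaming (_+_ to _+ℚ_)
open import Relation.Binary.PropositionalEquality using (_≡_)
open import Relation.Nullary using (¬_)

-- Expansion x x̄ : x̄ is an expansion of x (each character replaced by
-- one or more consecutive copies of itself).
data Expansion : List ℚ → List ℚ → Set where
  []   : Expansion [] []
  -- emit one more copy of the current head, which stays pending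
  copy : ∀ {a xs ys} → Expansion (a ∷ xs) ys → Expansion (a ∷ xs) (a ∷ ys)
  -- emit the last copy of the current head and move on
  step : ∀ {a xs ys} → Expansion xs ys → Expansion (a ∷ xs) (a ∷ ys)

-- ℓ1 distance of two sequences (used only on sequences of equal length)
l1 : List ℚ → List ℚ → ℚ
l1 xs ys = Data.List.foldr _+ℚ_ 0ℚ (zipWith (λ a b → ∣ a - b ∣) xs ys)

Correspondence : List ℚ → List ℚ → ℚ → Set
Correspondence x y d =
  ∃₂ λ x̄ ȳ → Expansion x x̄ × Expansion y ȳ × length x̄ ≡ length ȳ × l1 x̄ ȳ ≡ d

-- IsDTW x y r : r is the DTW distance of x and y;
-- nothing encodes +∞ (no correspondence exists, e.g. exactly one sequence empty).
IsDTW : List ℚ → List ℚ → Maybe ℚ → Set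
IsDTW x y nothing  = ∀ d → ¬ Correspondence x y d
IsDTW x y (just d) = Correspondence x y d × (∀ d′ → Correspondence x y d′ → d ≤ d′)

bitToℚ : Bool → ℚ
bitToℚ false = 0ℚ
bitToℚ true  = 1ℚ

-- Adaptive query algorithm: a decision tree. 'ask q k' queries q and
-- continues with k applied to the answer; 'done o' outputs o.
data Alg : Set where
  done : List Bool → Alg
  ask  : List ℚ → (Maybe ℚ → Alg) → Alg

run : Alg → (List ℚ → Maybe ℚ) → List (List ℚ) × List Bool
run (done o) f = [] , o
run (ask q k) f with run (k (f q)) f
... | qs , o = q ∷ qs , o

queries : Alg → (List ℚ → Maybe ℚ) → List (List ℚ)
queries A f = Data.Product.proj₁ (run A f)

output : Alg → (List ℚ → Maybe ℚ) → List Bool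
output A f = Data.Product.proj₂ (run A f)

ValidQuery : ℕ → ℚ → List ℚ → Set
ValidQuery n c q = length q ≤ℕ n × All (λ a → a ≡ 0ℚ ⊎ a ≡ 1ℚ ⊎ a ≡ c) q

{-# OPTIONS --safe #-}
-- With c = ½, the answer to the one-letter query c is ℓ/2 (+∞ when s is
-- empty), which reveals the length ℓ of s.  Position i < ℓ is then read from
-- the probe c^i 1 c^(ℓ-1-i): every c costs at least ½, so the answer is at
-- least (ℓ-1)/2, with equality when s_i = 1 (warp diagonally).  When s_i = 0
-- it is larger: either the 1 of the probe meets a 0 at cost 1, or the c's on
-- one side of it must absorb more characters of s than there are c's.
-- Costs are counted in half-units, so optimal warping becomes a question about ℕ.
module Submission where

open import Defs
open import Data.Bool using (Bool; true; false)
open import Data.List using (List; []; _∷_; length; map; _++_; _∷ʳ_; replicate)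
open import Data.List.Properties using (length-map; length-++; length-replicate; ∷ʳ-++)
open import Data.List.Relation.Unary.All using (All; []; _∷_)
open import Data.Maybe using (Maybe; just; nothing)
import Data.Maybe.Properties as Maybe
open import Data.Nat using (ℕ; zero; suc; _+_; _≤_; _<_; z≤n; s≤s; _≤?_)
open import Data.Nat.Properties
  using (≤-refl; ≤-trans; ≤-antisym; m≤n+m; n≤1+n; m≤n⇒m≤1+n; +-mono-≤; +-monoʳ-≤; +-comm;
         suc-injective; ≤∧≢⇒<; ≰⇒>; <-irrefl)
open import Data.Product using (Σ; _×_; _,_)
open import Data.Sum using (_⊎_; inj₁; inj₂)
open import Data.Rational using (ℚ; 0ℚ; 1ℚ; ½; ∣_∣; _-_)
import Data.Rational as ℚ
import Data.Rational.Properties as ℚ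
import Data.Integer as ℤ
open import Function using (_∘_)
open import Relation.Binary.PropositionalEquality
  using (_≡_; _≢_; refl; sym; trans; cong; cong₂; subst; module ≡-Reasoning)
open import Relation.Nullary using (yes; no; does; contradiction)
open import Relation.Nullary.Decidable using (dec-true; dec-false)

half : ℕ → ℚ
half zero    = 0ℚ
half (suc k) = ½ ℚ.+ half k

half-+ : ∀ m n → half (m + n) ≡ half m ℚ.+ half n
half-+ zero    n = sym (ℚ.+-identityˡ (half n))
half-+ (suc m) n = trans (cong (½ ℚ.+_) (half-+ m n)) (sym (ℚ.+-assoc ½ (half m) (half n)))

0<½ : 0ℚ ℚ.< ½
0<½ = ℚ.*<* (ℤ.+<+ (s≤s z≤n))

half-nonneg : ∀ n → 0ℚ ℚ.≤ half n
half-nonneg zero    = ℚ.≤-refl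
half-nonneg (suc n) = ℚ.+-mono-≤ (ℚ.<⇒≤ 0<½) (half-nonneg n)

half-mono-≤ : ∀ {m n} → m ≤ n → half m ℚ.≤ half n
half-mono-≤ {n = n} z≤n = half-nonneg n
half-mono-≤ (s≤s m≤n)  = ℚ.+-monoʳ-≤ ½ (half-mono-≤ m≤n)

half-mono-< : ∀ {m n} → m < n → half m ℚ.< half n
half-mono-< {n = suc n} (s≤s z≤n) = ℚ.+-mono-<-≤ 0<½ (half-nonneg n)
half-mono-< (s≤s (s≤s m<n))        = ℚ.+-monoʳ-< ½ (half-mono-< (s≤s m<n))

half-injective : ∀ {m n} → half m ≡ half n → m ≡ n
half-injective {m} {n} eq with m ≤? n | n ≤? m
... | yes m≤n | yes n≤m = ≤-antisym m≤n n≤m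
... | no m≰n  | _       = contradiction (sym eq) (ℚ.<⇒≢ (half-mono-< (≰⇒> m≰n)))
... | _       | no n≰m  = contradiction eq (ℚ.<⇒≢ (half-mono-< (≰⇒> n≰m)))

module Warping {A B : Set} (⟦_⟧ˡ : A → ℚ) (⟦_⟧ʳ : B → ℚ) (gap : A → B → ℕ)
                 (∣-∣≡half-gap : ∀ a b → ∣ ⟦ a ⟧ˡ - ⟦ b ⟧ʳ ∣ ≡ half (gap a b)) where

  -- A warping path of cost k/2; each constructor is a pair of Expansion
  -- constructors (copy or step) applied to the two sides.
  data Warp : List A → List B → ℕ → Set where
    end   : Warp [] [] 0
    again : ∀ {a b xs ys k} → Warp (a ∷ xs) (b ∷ ys) k → Warp (a ∷ xs) (b ∷ ys) (gap a b + k)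
    nextˡ : ∀ {a b xs ys k} → Warp xs (b ∷ ys) k → Warp (a ∷ xs) (b ∷ ys) (gap a b + k)
    nextʳ : ∀ {a b xs ys k} → Warp (a ∷ xs) ys k → Warp (a ∷ xs) (b ∷ ys) (gap a b + k)
    next  : ∀ {a b xs ys k} → Warp xs ys k → Warp (a ∷ xs) (b ∷ ys) (gap a b + k)

  l1-∷ : ∀ a b x̄ ȳ {k} → l1 x̄ ȳ ≡ half k → l1 (⟦ a ⟧ˡ ∷ x̄) (⟦ b ⟧ʳ ∷ ȳ) ≡ half (gap a b + k)
  l1-∷ a b x̄ ȳ {k} eq = begin
    ∣ ⟦ a ⟧ˡ - ⟦ b ⟧ʳ ∣ ℚ.+ l1 x̄ ȳ ≡⟨ cong₂ ℚ._+_ (∣-∣≡half-gap a b) eq ⟩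
    half (gap a b) ℚ.+ half k     ≡⟨ sym (half-+ (gap a b) k) ⟩
    half (gap a b + k)            ∎
    where open ≡-Reasoning

  warp⇒correspondence : ∀ {xs ys k} → Warp xs ys k →
                        Correspondence (map ⟦_⟧ˡ xs) (map ⟦_⟧ʳ ys) (half k)
  warp⇒correspondence end = [] , [] , [] , [] , refl , refl
  warp⇒correspondence (again {a} {b} w) with warp⇒correspondence w
  ... | x̄ , ȳ , ex , ey , len , cost = _ , _ , copy ex , copy ey , cong suc len , l1-∷ a b x̄ ȳ cost
  warp⇒correspondence (nextˡ {a} {b} w) with warp⇒correspondence w
  ... | x̄ , ȳ , ex , ey , len , cost = _ , _ , step ex , copy ey , cong suc len , l1-∷ a b x̄ ȳ cost
  warp⇒correspondence (nextʳ {a} {b} w) with warp⇒correspondence w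
  ... | x̄ , ȳ , ex , ey , len , cost = _ , _ , copy ex , step ey , cong suc len , l1-∷ a b x̄ ȳ cost
  warp⇒correspondence (next {a} {b} w) with warp⇒correspondence w
  ... | x̄ , ȳ , ex , ey , len , cost = _ , _ , step ex , step ey , cong suc len , l1-∷ a b x̄ ȳ cost

  expansions⇒warp : ∀ {xs ys x̄ ȳ} → Expansion (map ⟦_⟧ˡ xs) x̄ → Expansion (map ⟦_⟧ʳ ys) ȳ →
                    length x̄ ≡ length ȳ → Σ ℕ λ k → Warp xs ys k × l1 x̄ ȳ ≡ half k
  expansions⇒warp {[]}     {[]}     []       []       _ = 0 , end , refl
  expansions⇒warp {[]}     {_ ∷ _}  []       (copy _) ()
  expansions⇒warp {[]}     {_ ∷ _}  []       (step _) ()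
  expansions⇒warp {_ ∷ _}  {[]}     (copy _) []       ()
  expansions⇒warp {_ ∷ _}  {[]}     (step _) []       ()
  expansions⇒warp {a ∷ xs} {b ∷ ys} {_ ∷ x̄} {_ ∷ ȳ} (copy ex) (copy ey) len
    with expansions⇒warp {a ∷ xs} {b ∷ ys} ex ey (suc-injective len)
  ... | _ , w , cost = _ , again w , l1-∷ a b x̄ ȳ cost
  expansions⇒warp {a ∷ xs} {b ∷ ys} {_ ∷ x̄} {_ ∷ ȳ} (step ex) (copy ey) len
    with expansions⇒warp {xs} {b ∷ ys} ex ey (suc-injective len)
  ... | _ , w , cost = _ , nextˡ w , l1-∷ a b x̄ ȳ cost
  expansions⇒warp {a ∷ xs} {b ∷ ys} {_ ∷ x̄} {_ ∷ ȳ} (copy ex) (step ey) len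
    with expansions⇒warp {a ∷ xs} {ys} ex ey (suc-injective len)
  ... | _ , w , cost = _ , nextʳ w , l1-∷ a b x̄ ȳ cost
  expansions⇒warp {a ∷ xs} {b ∷ ys} {_ ∷ x̄} {_ ∷ ȳ} (step ex) (step ey) len
    with expansions⇒warp {xs} {ys} ex ey (suc-injective len)
  ... | _ , w , cost = _ , next w , l1-∷ a b x̄ ȳ cost

  DTW : List A → List B → Maybe ℚ → Set
  DTW xs ys = IsDTW (map ⟦_⟧ˡ xs) (map ⟦_⟧ʳ ys)

  dtw-optimal : ∀ {xs ys r k} → DTW xs ys r → Warp xs ys k →
                (∀ {k′} → Warp xs ys k′ → k ≤ k′) → r ≡ just (half k)
  dtw-optimal {r = nothing} noCorr w _ = contradiction (warp⇒correspondence w) (noCorr _)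
  dtw-optimal {r = just d} {k} ((_ , _ , ex , ey , len , cost) , minimal) w optimal
    with expansions⇒warp ex ey len
  ... | _ , w′ , cost′ = cong just (ℚ.≤-antisym (minimal _ (warp⇒correspondence w))
    (subst (half k ℚ.≤_) (trans (sym cost′) cost) (half-mono-≤ (optimal w′))))

  dtw-above : ∀ {xs ys r m} → DTW xs ys r →
              (∀ {k} → Warp xs ys k → m < k) → r ≢ just (half m)
  dtw-above {r = just d} ((_ , _ , ex , ey , len , cost) , _) above refl
    with expansions⇒warp ex ey len
  ... | _ , w , cost′ = <-irrefl (half-injective (trans (sym cost) cost′)) (above w)

c : ℚ
c = ½

data Letter : Set where
  one mid : Letter

⟦_⟧ : Letter → ℚ
⟦ one ⟧ = 1ℚ
⟦ mid ⟧ = c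

gap : Bool → Letter → ℕ
gap _     mid = 1
gap true  one = 0
gap false one = 2

∣-∣≡half-gap : ∀ a b → ∣ bitToℚ a - ⟦ b ⟧ ∣ ≡ half (gap a b)
∣-∣≡half-gap true  one = refl
∣-∣≡half-gap false one = refl
∣-∣≡half-gap true  mid = refl
∣-∣≡half-gap false mid = refl

open Warping bitToℚ ⟦_⟧ gap ∣-∣≡half-gap

mids : ℕ → List Letter
mids n = replicate n mid

probe : ℕ → ℕ → List Letter
probe α β = mids α ++ one ∷ mids β

midCount : Letter → ℕ
midCount one = 0
midCount mid = 1

#mid : List Letter → ℕ
#mid []       = 0
#mid (b ∷ ys) = midCount b + #mid ys

#mid-mids : ∀ n → #mid (mids n) ≡ n
#mid-mids zero    = refl
#mid-mids (suc n) = cong suc (#mid-mids n)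

#mid-probe : ∀ α β → #mid (probe α β) ≡ α + β
#mid-probe zero    β = #mid-mids β
#mid-probe (suc α) β = cong suc (#mid-probe α β)

length-probe : ∀ α β → length (probe α β) ≡ α + suc β
length-probe zero    β = cong suc (length-replicate β)
length-probe (suc α) β = cong suc (length-probe α β)

midCount≤gap : ∀ a b → midCount b ≤ gap a b
midCount≤gap a one = z≤n
midCount≤gap a mid = ≤-refl

#mid≤cost : ∀ {xs ys k} → Warp xs ys k → #mid ys ≤ k
#mid≤cost end                       = z≤n
#mid≤cost (again {a} {b} {k = k} w) = ≤-trans (#mid≤cost w) (m≤n+m k (gap a b))
#mid≤cost (nextˡ {a} {b} {k = k} w) = ≤-trans (#mid≤cost w) (m≤n+m k (gap a b))
#mid≤cost (nextʳ {a} {b} w)         = +-mono-≤ (midCount≤gap a b) (#mid≤cost w)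
#mid≤cost (next {a} {b} w)          = +-mono-≤ (midCount≤gap a b) (#mid≤cost w)

head-cost : ∀ {a b xs ys k} → Warp (a ∷ xs) (b ∷ ys) k → gap a b + #mid ys ≤ k
head-cost (again {a} {b} w) = +-monoʳ-≤ (gap a b) (≤-trans (m≤n+m _ (midCount b)) (#mid≤cost w))
head-cost (nextˡ {a} {b} w) = +-monoʳ-≤ (gap a b) (≤-trans (m≤n+m _ (midCount b)) (#mid≤cost w))
head-cost (nextʳ {a} {b} w) = +-monoʳ-≤ (gap a b) (#mid≤cost w)
head-cost (next {a} {b} w)  = +-monoʳ-≤ (gap a b) (#mid≤cost w)

length≤cost : ∀ {xs m k} → Warp xs (mids m) k → length xs ≤ k
length≤cost {m = suc m} (again w) = m≤n⇒m≤1+n (length≤cost {m = suc m} w)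
length≤cost {m = suc m} (nextˡ w) = s≤s (length≤cost {m = suc m} w)
length≤cost {m = suc m} (nextʳ w) = m≤n⇒m≤1+n (length≤cost {m = m} w)
length≤cost {m = suc m} (next w)  = s≤s (length≤cost {m = m} w)
length≤cost {m = zero}  end       = z≤n

suc-length≤length-++-∷ : ∀ {X : Set} (p : List X) x t → suc (length t) ≤ length (p ++ x ∷ t)
suc-length≤length-++-∷ p x t = subst (suc (length t) ≤_) (sym (length-++ p)) (m≤n+m _ (length p))

α+β≤cost : ∀ {xs α β k} → Warp xs (probe α β) k → α + β ≤ k
α+β≤cost {α = α} {β} {k} w = subst (_≤ k) (#mid-probe α β) (#mid≤cost w)

zero-under-one : ∀ β p t {k} → Warp (p ++ false ∷ t) (one ∷ mids β) k → β ≤ length t → suc β ≤ k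
zero-under-one β []      t w _ =
  ≤-trans (n≤1+n (suc β)) (subst (λ m → 2 + m ≤ _) (#mid-mids β) (head-cost w))
zero-under-one β (a ∷ p) t (again {k = k} w) β≤ = ≤-trans (zero-under-one β (a ∷ p) t w β≤) (m≤n+m k (gap a one))
zero-under-one β (a ∷ p) t (nextˡ {k = k} w) β≤ = ≤-trans (zero-under-one β p t w β≤) (m≤n+m k (gap a one))
zero-under-one β (a ∷ p) t (nextʳ {k = k} w) β≤ =
  ≤-trans (s≤s β≤) (≤-trans (suc-length≤length-++-∷ (a ∷ p) false t)
    (≤-trans (length≤cost w) (m≤n+m k (gap a one))))
zero-under-one β (a ∷ p) t (next {k = k} w) β≤ =
  ≤-trans (s≤s β≤) (≤-trans (suc-length≤length-++-∷ p false t)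
    (≤-trans (length≤cost w) (m≤n+m k (gap a one))))

zero-under-probe : ∀ α β p t {k} → Warp (p ++ false ∷ t) (probe α β) k →
                   α ≤ length p → β ≤ length t → suc (α + β) ≤ k
zero-under-probe zero    β p       t w         _        β≤ = zero-under-one β p t w β≤
-- In the next two cases the leading mid is paid here and once more inside w.
zero-under-probe (suc α) β (a ∷ p) t (again w) _        _  =
  s≤s (α+β≤cost {α = suc α} w)
zero-under-probe (suc α) β (a ∷ p) t (nextˡ w) _        _  =
  s≤s (α+β≤cost {α = suc α} w)
zero-under-probe (suc α) β (a ∷ p) t (nextʳ w) (s≤s α≤) β≤ =
  s≤s (zero-under-probe α β (a ∷ p) t w (m≤n⇒m≤1+n α≤) β≤)
zero-under-probe (suc α) β (a ∷ p) t (next w)  (s≤s α≤) β≤ = s≤s (zero-under-probe α β p t w α≤ β≤)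

diagonal : ∀ xs → Warp xs (mids (length xs)) (length xs)
diagonal []       = end
diagonal (x ∷ xs) = next (diagonal xs)

one-under-probe : ∀ p t → Warp (p ++ true ∷ t) (probe (length p) (length t)) (length p + length t)
one-under-probe []      t = next (diagonal t)
one-under-probe (a ∷ p) t = next (one-under-probe p t)

collapse : ∀ x xs → Warp (x ∷ xs) (mids 1) (length (x ∷ xs))
collapse x []       = next end
collapse x (y ∷ xs) = nextˡ (collapse y xs)

readBit : ℕ → Maybe ℚ → Bool
readBit m r = does (Maybe.≡-dec ℚ._≟_ r (just (half m)))

readBit-probe : ∀ p b t {r} → DTW (p ++ b ∷ t) (probe (length p) (length t)) r →
                readBit (length p + length t) r ≡ b
readBit-probe p true  t {r} dtw =
  dec-true (Maybe.≡-dec ℚ._≟_ r _) (dtw-optimal dtw (one-under-probe p t) α+β≤cost)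
readBit-probe p false t {r} dtw =
  dec-false (Maybe.≡-dec ℚ._≟_ r _)
    (dtw-above dtw (λ w → zero-under-probe (length p) (length t) p t w ≤-refl ≤-refl))

search : ℕ → ℚ → ℕ
search zero    d = 0
search (suc m) d with d ℚ.≟ half (suc m)
... | yes _ = suc m
... | no _  = search m d

search-half : ∀ {m j} → j ≤ m → search m (half j) ≡ j
search-half {zero} z≤n = refl
search-half {suc m} {j} j≤1+m with half j ℚ.≟ half (suc m)
... | yes eq = sym (half-injective eq)
... | no neq with ≤∧≢⇒< j≤1+m (neq ∘ cong half)
...   | s≤s j≤m = search-half j≤m

lengthFrom : ℕ → Maybe ℚ → ℕ
lengthFrom n nothing  = 0
lengthFrom n (just d) = search n d

lengthFrom-dtw : ∀ {n xs r} → length xs ≤ n → DTW xs (mids 1) r → lengthFrom n r ≡ length xs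
lengthFrom-dtw {xs = []}     {nothing} _   _ = refl
lengthFrom-dtw {xs = []}     {just _}  _   ((_ , _ , ex , ey , len , _) , _) with expansions⇒warp {[]} {mids 1} ex ey len
... | _ , () , _
lengthFrom-dtw {xs = x ∷ xs} {r} ≤n dtw
  rewrite dtw-optimal dtw (collapse x xs) length≤cost = search-half ≤n

_◂_ : Bool → Alg → Alg
b ◂ done o  = done (b ∷ o)
b ◂ ask q k = ask q (λ r → b ◂ k r)

run-◂ : ∀ b A f → run (b ◂ A) f ≡ (queries A f , b ∷ output A f)
run-◂ b (done o)  f = refl
run-◂ b (ask q k) f rewrite run-◂ b (k (f q)) f = refl

query : List Letter → List ℚ
query = map ⟦_⟧

valid-query : ∀ {n} ys → length ys ≤ n → ValidQuery n c (query ys)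
valid-query {n} ys ≤n = subst (_≤ n) (sym (length-map ⟦_⟧ ys)) ≤n , letters ys
  where
  letters : ∀ ys → All (λ x → x ≡ 0ℚ ⊎ x ≡ 1ℚ ⊎ x ≡ c) (query ys)
  letters []         = []
  letters (one ∷ ys) = inj₂ (inj₁ refl) ∷ letters ys
  letters (mid ∷ ys) = inj₂ (inj₂ refl) ∷ letters ys

-- readFrom α β reads the remaining β bits of a sequence whose first α bits are known.
readFrom : ℕ → ℕ → Alg
readFrom α zero    = done []
readFrom α (suc β) = ask (query (probe α β)) λ r → readBit (α + β) r ◂ readFrom (suc α) β

recover : ℕ → Alg
recover n = ask (query (mids 1)) λ r → readFrom 0 (lengthFrom n r)

length-∷ʳ : ∀ {X : Set} (xs : List X) x → length (xs ∷ʳ x) ≡ suc (length xs)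
length-∷ʳ xs x = trans (length-++ xs) (+-comm (length xs) 1)

readFrom-correct : ∀ {n s f} → (∀ q → IsDTW (map bitToℚ s) q (f q)) → length s ≤ n →
                   ∀ p t α → length p ≡ α → s ≡ p ++ t →
                   output (readFrom α (length t)) f ≡ t
                   × length (queries (readFrom α (length t)) f) ≡ length t
                   × All (ValidQuery n c) (queries (readFrom α (length t)) f)
readFrom-correct oracle ≤n p []      α _    _  = refl , refl , []
readFrom-correct {n} {s} {f} oracle ≤n p (b ∷ t) α refl s≡
  rewrite run-◂ (readBit (α + length t) (f (query (probe α (length t)))))
                (readFrom (suc α) (length t)) f
  with readFrom-correct oracle ≤n (p ∷ʳ b) t (suc α) (length-∷ʳ p b) (trans s≡ (sym (∷ʳ-++ p b t)))
... | output≡ , #queries≡ , valid =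
  cong₂ _∷_ (readBit-probe p b t
    (subst (λ x → DTW x (probe α (length t)) (f (query (probe α (length t))))) s≡ (oracle _))) output≡ ,
  cong suc #queries≡ ,
  valid-query (probe α (length t))
    (subst (_≤ n) (trans (cong length s≡) (trans (length-++ p) (sym (length-probe α (length t))))) ≤n)
  ∷ valid

recover-correct : ∀ {n} → 1 ≤ n → (s : List Bool) → length s ≤ n →
                  (f : List ℚ → Maybe ℚ) → (∀ q → IsDTW (map bitToℚ s) q (f q)) →
                  output (recover n) f ≡ s
                  × length (queries (recover n) f) ≤ suc n
                  × All (ValidQuery n c) (queries (recover n) f)
recover-correct {n} 1≤n s ≤n f oracle
  rewrite lengthFrom-dtw ≤n (oracle (query (mids 1)))
  with readFrom-correct oracle ≤n [] s 0 refl refl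
... | output≡ , #queries≡ , valid =
  output≡ , subst (_≤ suc n) (sym (cong suc #queries≡)) (s≤s ≤n) , valid-query (mids 1) 1≤n ∷ valid

mainTheorem4 : (n : ℕ) → 1 ≤ n →
    Σ ℚ λ c → c ≢ 0ℚ × c ≢ 1ℚ × Σ Alg λ A →
    (s : List Bool) → length s ≤ n →
    (f : List ℚ → Maybe ℚ) → (∀ q → IsDTW (map bitToℚ s) q (f q)) →
    output A f ≡ s
    × length (queries A f) ≤ suc n
    × All (ValidQuery n c) (queries A f)
mainTheorem4 n 1≤n = c , (λ ()) , (λ ()) , recover n , recover-correct 1≤n
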